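{- Let $G$ be a split graph with split partition $(K,I)$, let $T=I$ be the set of terminals, and let $k$ be an integer. Let $v\in K$ be such that the bipartite graph $B(v)$ contains a matching of size at least $k+1$. Then every subset feedback vertex set of $G$ with respect to $T$ of size at most $k$ contains $v$.
   Context: A split graph has vertex set partitioned into a clique $K$ and an independent set $I$. For a terminal set $T$, a $T$-cycle is a cycle containing a vertex of $T$, and a subset feedback vertex set with respect to $T$ is a set $S$ such that $G-S$ has no $T$-cycle. For $v\in K$: $N_1(v)=N(v)\cap I$, $N_2(v)=N(N_1(v))\setminus\{v\}$ (the vertices other than $v$ adjacent to some vertex of $N_1(v)$), and $B(v)$ is the bipartite graph obtained from $G[N_1(v)\cup N_2(v)]$ by deleting every edge with both endpoints in $N_2(v)$. -}

module Defs where

open import Data.Nat using (ℕ; suc; _≤_)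
open import Data.Fin using (Fin; zero; suc; inject₁; fromℕ)
open import Data.Fin.Subset using (Subset; _∈_; _∉_; ∣_∣)
open import Data.Product using (_×_; _,_; Σ; ∃; ∃-syntax; proj₁; proj₂)
open import Data.List using (List; length; concatMap; _∷_; [])
open import Data.List.Relation.Unary.All using (All)
open import Data.List.Relation.Unary.Unique.Propositional using (Unique)
open import Relation.Nullary using (¬_)
open import Relation.Binary.PropositionalEquality using (_≡_; _≢_)
open import Function.Definitions using (Injective)

record Graph (n : ℕ) : Set₁ where
  field
    E     : Fin n → Fin n → Set
    sym   : ∀ {u v} → E u v → E v u
    irrefl : ∀ {u} → ¬ E u u
open Graph public

IsSplitPartition : ∀ {n} → Graph n → Subset n → Set
IsSplitPartition {n} G K =
  (∀ (u v : Fin n) → u ∈ K → v ∈ K → u ≢ v → E G u v) ×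
  (∀ (u v : Fin n) → u ∉ K → v ∉ K → ¬ E G u v)

-- Vertices of the independent side I (= the terminals T here).
InI : ∀ {n} → Subset n → Fin n → Set
InI K u = u ∉ K

record Cycle {n} (G : Graph n) : Set where
  field
    m     : ℕ
    vert  : Fin (suc (suc (suc m))) → Fin n
    inj   : Injective _≡_ _≡_ vert
    step  : ∀ (i : Fin (suc (suc m))) → E G (vert (inject₁ i)) (vert (suc i))
    close : E G (vert (fromℕ (suc (suc m)))) (vert zero)
open Cycle public

TCycleAvoiding : ∀ {n} → Graph n → (T : Fin n → Set) → Subset n → Set
TCycleAvoiding G T S =
  Σ (Cycle G) λ C → (∃[ i ] T (vert C i)) × (∀ i → vert C i ∉ S)

IsSubsetFVS : ∀ {n} → Graph n → (T : Fin n → Set) → Subset n → Set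
IsSubsetFVS G T S = ¬ TCycleAvoiding G T S

InN₁ : ∀ {n} → Graph n → Subset n → Fin n → Fin n → Set
InN₁ G K v u = InI K u × E G v u

InN₂ : ∀ {n} → Graph n → Subset n → Fin n → Fin n → Set
InN₂ G K v w = w ≢ v × (∃[ u ] (InN₁ G K v u × E G w u))

EdgeB : ∀ {n} → Graph n → Subset n → Fin n → Fin n → Fin n → Set
EdgeB G K v x y =
  (InN₁ G K v x Data.Sum.⊎ InN₂ G K v x) ×
  (InN₁ G K v y Data.Sum.⊎ InN₂ G K v y) ×
  E G x y ×
  ¬ (InN₂ G K v x × InN₂ G K v y)
  where import Data.Sum

IsMatchingB : ∀ {n} → Graph n → Subset n → Fin n → List (Fin n × Fin n) → Set
IsMatchingB G K v M =
  All (λ e → EdgeB G K v (proj₁ e) (proj₂ e)) M ×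
  Unique (concatMap (λ e → proj₁ e ∷ proj₂ e ∷ []) M)

{-# OPTIONS --safe #-}
module Submission where

open import Defs
open import Data.Nat using (ℕ; suc; _≤_; s≤s; z≤n)
open import Data.Nat.Properties using (≤-trans; <⇒≱)
open import Data.Fin using (Fin; zero; suc)
open import Data.Fin.Subset using (Subset; _∈_; _∉_; ∣_∣; _-_)
open import Data.Fin.Subset.Properties using (_∈?_; x∈p⇒∣p-x∣<∣p∣; x∈p∧x≢y⇒x∈p-y)
open import Data.Product using (_×_; _,_; proj₁; proj₂)
open import Data.Sum using (_⊎_; inj₁; inj₂)
open import Data.List using (List; length; _∷_; []; concatMap)
open import Data.List.Relation.Unary.All as All using (All; _∷_; [])
open import Data.List.Relation.Unary.AllPairs using (_∷_)
open import Data.List.Relation.Unary.Unique.Propositional using (Unique)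
open import Data.Empty using (⊥; ⊥-elim)
open import Relation.Nullary using (yes; no; contradiction)
open import Relation.Binary.PropositionalEquality using (_≡_; _≢_; refl; ≢-sym)
  renaming (sym to ≡-sym)

-- If v ∉ S, each edge of B(v) is covered by S: an uncovered edge between N₁(v)
-- and N₂(v) would close a triangle through v and a terminal, while N₁(v) ⊆ I
-- spans no edges. A matching of B(v) therefore forces more than k vertices
-- into S, one per matching edge.

endpoints : ∀ {n} → List (Fin n × Fin n) → List (Fin n)
endpoints = concatMap (λ e → proj₁ e ∷ proj₂ e ∷ [])

Touches : ∀ {n} → Subset n → Fin n × Fin n → Set
Touches S e = proj₁ e ∈ S ⊎ proj₂ e ∈ S

All-Touches-remove : ∀ {n} {S : Subset n} x (M : List (Fin n × Fin n)) →
                     All (x ≢_) (endpoints M) → All (Touches S) M → All (Touches (S - x)) M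
All-Touches-remove x [] [] [] = []
All-Touches-remove {S = S} x ((a , b) ∷ M) (x≢a ∷ x≢b ∷ fresh) (t ∷ ts) =
  touch t ∷ All-Touches-remove x M fresh ts
  where
  touch : Touches S (a , b) → Touches (S - x) (a , b)
  touch (inj₁ a∈S) = inj₁ (x∈p∧x≢y⇒x∈p-y a∈S (≢-sym x≢a))
  touch (inj₂ b∈S) = inj₂ (x∈p∧x≢y⇒x∈p-y b∈S (≢-sym x≢b))

length≤∣cover∣ : ∀ {n} {S : Subset n} (M : List (Fin n × Fin n)) →
                 Unique (endpoints M) → All (Touches S) M → length M ≤ ∣ S ∣
length≤∣cover∣ [] _ [] = z≤n
length≤∣cover∣ ((a , _) ∷ M) ((_ ∷ a-fresh) ∷ _ ∷ u) (inj₁ a∈S ∷ ts) =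
  ≤-trans (s≤s (length≤∣cover∣ M u (All-Touches-remove a M a-fresh ts))) (x∈p⇒∣p-x∣<∣p∣ a∈S)
length≤∣cover∣ ((_ , b) ∷ M) (_ ∷ b-fresh ∷ u) (inj₂ b∈S ∷ ts) =
  ≤-trans (s≤s (length≤∣cover∣ M u (All-Touches-remove b M b-fresh ts))) (x∈p⇒∣p-x∣<∣p∣ b∈S)

triangle : ∀ {n} (G : Graph n) {a b c : Fin n} → a ≢ b → b ≢ c → c ≢ a →
           E G a b → E G b c → E G c a → Cycle G
triangle {n} G {a} {b} {c} a≢b b≢c c≢a ab bc ca = record
  { m = 0 ; vert = corner ; inj = corner-injective
  ; step = λ { zero → ab ; (suc zero) → bc } ; close = ca }
  where
  corner : Fin 3 → Fin n
  corner zero = a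
  corner (suc zero) = b
  corner (suc (suc zero)) = c

  corner-injective : ∀ {i j} → corner i ≡ corner j → i ≡ j
  corner-injective {zero}             {zero}             _ = refl
  corner-injective {suc zero}         {suc zero}         _ = refl
  corner-injective {suc (suc zero)}   {suc (suc zero)}   _ = refl
  corner-injective {zero}             {suc zero}         e = ⊥-elim (a≢b e)
  corner-injective {suc zero}         {zero}             e = ⊥-elim (a≢b (≡-sym e))
  corner-injective {suc zero}         {suc (suc zero)}   e = ⊥-elim (b≢c e)
  corner-injective {suc (suc zero)}   {suc zero}         e = ⊥-elim (b≢c (≡-sym e))
  corner-injective {suc (suc zero)}   {zero}             e = ⊥-elim (c≢a e)
  corner-injective {zero}             {suc (suc zero)}   e = ⊥-elim (c≢a (≡-sym e))

module _ {n} {G : Graph n} {K : Subset n} (split : IsSplitPartition G K)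
         {v : Fin n} (v∈K : v ∈ K) {S : Subset n}
         (fvs : IsSubsetFVS G (InI K) S) (v∉S : v ∉ S) where

  uncovered-N₁-edge-absurd : ∀ {u w} → InN₁ G K v u → w ≢ v → E G u w →
                             u ∉ S → w ∉ S → ⊥
  uncovered-N₁-edge-absurd {u} {w} (u∉K , vu) w≢v uw u∉S w∉S with w ∈? K
  ... | no w∉K = proj₂ split u w u∉K w∉K uw
  ... | yes w∈K = fvs (vuw , (suc zero , u∉K) , avoids)
    where
    v≢u : v ≢ u
    v≢u refl = u∉K v∈K
    u≢w : u ≢ w
    u≢w refl = u∉K w∈K
    wv : E G w v
    wv = proj₁ split w v w∈K v∈K w≢v
    vuw : Cycle G
    vuw = triangle G v≢u u≢w w≢v vu uw wv
    avoids : ∀ i → vert vuw i ∉ S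
    avoids zero = v∉S
    avoids (suc zero) = u∉S
    avoids (suc (suc zero)) = w∉S

  EdgeB-Touches : ∀ {x y} → EdgeB G K v x y → Touches S (x , y)
  EdgeB-Touches {x} {y} eb with x ∈? S | y ∈? S
  ... | yes x∈S | _ = inj₁ x∈S
  ... | no _ | yes y∈S = inj₂ y∈S
  ... | no x∉S | no y∉S with eb
  ... | inj₁ (x∉K , _) , inj₁ (y∉K , _) , xy , _ = ⊥-elim (proj₂ split x y x∉K y∉K xy)
  ... | inj₁ x∈N₁ , inj₂ (y≢v , _) , xy , _ =
    ⊥-elim (uncovered-N₁-edge-absurd x∈N₁ y≢v xy x∉S y∉S)
  ... | inj₂ (x≢v , _) , inj₁ y∈N₁ , xy , _ =
    ⊥-elim (uncovered-N₁-edge-absurd y∈N₁ x≢v (Graph.sym G xy) y∉S x∉S)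
  ... | inj₂ x∈N₂ , inj₂ y∈N₂ , _ , not-both-N₂ = ⊥-elim (not-both-N₂ (x∈N₂ , y∈N₂))

lemma11 : ∀ {n} (G : Graph n) (K : Subset n) → IsSplitPartition G K →
          (k : ℕ) (v : Fin n) → v ∈ K →
          (M : List (Fin n × Fin n)) → IsMatchingB G K v M → suc k ≤ length M →
          (S : Subset n) → IsSubsetFVS G (InI K) S → ∣ S ∣ ≤ k → v ∈ S
lemma11 G K split k v v∈K M (edges , unique) k<∣M∣ S fvs ∣S∣≤k with v ∈? S
... | yes v∈S = v∈S
... | no v∉S = contradiction ∣S∣≤k (<⇒≱ k<∣S∣)
  where
  k<∣S∣ : suc k ≤ ∣ S ∣
  k<∣S∣ = ≤-trans k<∣M∣
    (length≤∣cover∣ M unique (All.map (EdgeB-Touches split v∈K fvs v∉S) edges))
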